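{- Let $G_{2,6}$ be a regular $2$-balanced $6$-partite tournament with partite sets $V_i=\{v_{i,1},v_{i,2}\}$, $i\in[6]$, and let $G_{2,5}$ be obtained by deleting $V_6$. For any irregular partite set $V_i$ of $G_{2,5}$ with $i\in [5]$, if $n(V_i) = 4$ (computed in $G_{2,5}$), then $V_i$ controls-2 another partite set $V_j$ or $V_i$ is controlled-2 by $V_6$.
   Context: $G_{2,6}$ is an orientation of the complete $6$-partite graph with all partite sets of size $2$, regular meaning $d^+(v)=d^-(v)$ for every vertex; $G_{2,5}$ is then nearly regular ($|d^+(v)-d^-(v)|\le 2$). A partite set of $G_{2,5}$ is irregular if both its vertices have $d^+\ne d^-$ in $G_{2,5}$. A partition of $G_{2,5}$ into maximal tournaments splits its vertices into two disjoint tournaments of order $5$, each with one vertex of every partite set; it is non-strong if one of them is not strongly connected. $T_{u,\tau}$ is the tournament of partition $\tau$ containing $u$, $\delta_T(u)=\min\{d_T^+(u),d_T^-(u)\}$, and $n(V_i)$ is the number of non-strong partitions $\tau$ of $G_{2,5}$ for which some $u\in V_i$ has $\delta_{T_{u,\tau}}(u)=0$. $V_a$ controls-2 $V_b$ if there are exactly two arcs from $V_a$ to $V_b$ and $|N^{+}(v_{b,1}) \cap V_a| \neq 1$, $|N^{+}(v_{b,2}) \cap V_a| \neq 1$. -}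

module Defs where

open import Data.Nat using (ℕ; zero; suc)
open import Data.Bool using (Bool; true; false; _∧_; _∨_; not; if_then_else_)
open import Data.Fin using (Fin; zero; suc; inject₁; fromℕ; _≟_)
open import Data.Product using (_×_; _,_; proj₁; proj₂; Σ)
open import Data.Sum using (_⊎_)
open import Data.List using (List; []; _∷_; map; concatMap; allFin)
open import Data.Bool.ListAction using (any; all)
open import Data.Nat.ListAction using (sum)
open import Data.Vec using (Vec; lookup) renaming ([] to []ᵛ; _∷_ to _∷ᵛ_)
open import Relation.Binary.PropositionalEquality using (_≡_; _≢_)
open import Relation.Nullary.Decidable using (⌊_⌋)

-- Vertices of the 2-balanced 6-partite setting: v_{i,a} = (i , a),
-- partite set V_i = {(i,0),(i,1)}, i : Fin 6.  V_6 is index fromℕ 5.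

V : Set
V = Fin 6 × Fin 2

eqV : V → V → Bool
eqV (i , a) (j , b) = ⌊ i ≟ j ⌋ ∧ ⌊ a ≟ b ⌋

record MultipartiteTournament : Set where
  field
    arc      : V → V → Bool
    noInside : ∀ i a b → arc (i , a) (i , b) ≡ false
    total    : ∀ i a j b → i ≢ j →
               arc (i , a) (j , b) ≡ true ⊎ arc (j , b) (i , a) ≡ true
    asym     : ∀ u v → arc u v ≡ true → arc v u ≡ false

count : {A : Set} → (A → Bool) → List A → ℕ
count p [] = 0
count p (x ∷ xs) = if p x then suc (count p xs) else count p xs

verts6 : List V
verts6 = concatMap (λ i → map (λ a → (i , a)) (allFin 2)) (allFin 6)

verts5 : List V
verts5 = concatMap (λ i → map (λ a → (inject₁ i , a)) (allFin 2)) (allFin 5)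

V6 : Fin 6
V6 = fromℕ 5

module _ (G : MultipartiteTournament) where
  open MultipartiteTournament G

  outdegIn : List V → V → ℕ
  outdegIn L u = count (λ w → arc u w) L

  indegIn : List V → V → ℕ
  indegIn L u = count (λ w → arc w u) L

  Regular : Set
  Regular = ∀ v → outdegIn verts6 v ≡ indegIn verts6 v

  Irregular5 : Fin 5 → Set
  Irregular5 i = ∀ a → outdegIn verts5 (inject₁ i , a) ≢ indegIn verts5 (inject₁ i , a)

  -- A partition is encoded by s : Vec (Fin 2) 5 with s[0] = 0:
  -- tournament A = {(i , s i)}, tournament B = {(i , 1 - s i)}.
  -- Fixing s[0] = 0 picks one representative per unordered partition.

  flip2 : Fin 2 → Fin 2
  flip2 zero = suc zero
  flip2 (suc _) = zero

  allVecs : (n : ℕ) → List (Vec (Fin 2) n)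
  allVecs zero = []ᵛ ∷ []
  allVecs (suc n) = concatMap (λ v → (zero ∷ᵛ v) ∷ (suc zero ∷ᵛ v) ∷ []) (allVecs n)

  Partition : Set
  Partition = Vec (Fin 2) 5

  partitions : List Partition
  partitions = map (λ v → zero ∷ᵛ v) (allVecs 4)

  tourA : Partition → List V
  tourA s = map (λ i → (inject₁ i , lookup s i)) (allFin 5)

  tourB : Partition → List V
  tourB s = map (λ i → (inject₁ i , flip2 (lookup s i))) (allFin 5)

  tourOf : Partition → Fin 5 → Fin 2 → List V
  tourOf s i a = if ⌊ lookup s i ≟ a ⌋ then tourA s else tourB s

  reach : List V → ℕ → V → V → Bool
  reach L zero u v = eqV u v
  reach L (suc k) u v = eqV u v ∨ any (λ w → arc u w ∧ reach L k w v) L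

  -- strong connectivity of a tournament of order 5 (every path in it has
  -- length ≤ 4, so bounded reachability with bound 4 is reachability)
  strong : List V → Bool
  strong L = all (λ u → all (λ v → reach L 4 u v) L) L

  nonStrong : Partition → Bool
  nonStrong s = not (strong (tourA s)) ∨ not (strong (tourB s))

  isZero : ℕ → Bool
  isZero zero = true
  isZero (suc _) = false

  deltaZero : List V → V → Bool
  deltaZero T u = isZero (outdegIn T u) ∨ isZero (indegIn T u)

  nV : Fin 5 → ℕ
  nV i = count (λ s → nonStrong s ∧
                 any (λ a → deltaZero (tourOf s i a) (inject₁ i , a)) (allFin 2))
               partitions

  arcsFromTo : Fin 6 → Fin 6 → ℕ
  arcsFromTo p q = sum (map (λ x → count (λ y → arc (p , x) (q , y)) (allFin 2)) (allFin 2))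

  outIntoPart : V → Fin 6 → ℕ
  outIntoPart v p = count (λ y → arc v (p , y)) (allFin 2)

  Controls2 : Fin 6 → Fin 6 → Set
  Controls2 p q = arcsFromTo p q ≡ 2 × (∀ b → outIntoPart (q , b) p ≢ 1)

{-# OPTIONS --safe #-}
module Submission where

-- In G₂,₆ every vertex has out-degree 5, so a vertex u of V_i has out-degree
-- 5 − |N⁺(u) ∩ V₆| in G₂,₅, and irregularity excludes 4: each vertex of V_i has
-- out-degree 5 (beating no vertex of V₆) or 3 (beating both). If the two vertices
-- of V_i differ, both vertices of V₆ beat the same single vertex of V_i, so V₆
-- controls-2 V_i. If they agree, whether v_{i,a} has δ = 0 in its tournament only
-- depends on its arcs to the other four partite sets of G₂,₅, and an exhaustive
-- check over all such pairs of neighbourhoods shows that at most three partitions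
-- produce δ = 0 unless the two vertices of V_i have the same single out-neighbour
-- in some V_j — which is exactly V_i controlling-2 V_j.

open import Defs
open import Data.Bool using (Bool; true; false; T; not; _∧_; _∨_; if_then_else_)
open import Data.Bool.Properties using (T-≡; T-∨; ∨-identityʳ; ∨-inverseʳ) renaming (_≟_ to _≟ᵇ_)
open import Data.Bool.ListAction using (any; all)
open import Data.Empty using (⊥-elim)
open import Data.Fin using (Fin; zero; suc; inject₁; punchIn; _≟_)
open import Data.Fin.Properties using (punchInᵢ≢i; inject₁-injective; fromℕ≢inject₁; any?)
open import Data.List
  using (List; []; _∷_; _++_; map; concatMap; zipWith; tabulate; allFin; length; filter; cartesianProductWith)
open import Data.List.Properties using (map-tabulate; tabulate-cong; map-cong)
open import Data.List.Membership.Propositional using (_∈_)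
open import Data.List.Membership.Propositional.Properties
  using (∈-map⁺; ∈-filter⁺; ∈-allFin; ∈-cartesianProductWith⁺)
import Data.List.Relation.Unary.All as All
open import Data.List.Relation.Unary.All.Properties using (all⁺)
open import Data.List.Relation.Unary.Any using (here; there)
open import Data.Nat using (ℕ; zero; suc; _+_; _≤_; _≤ᵇ_; z≤n; s≤s)
open import Data.Nat.ListAction using (sum)
open import Data.Nat.Properties
  using (+-suc; suc-injective; m≤n⇒m≤1+n; ≤-trans; ≤-reflexive; <-cmp; <-irrefl; +-mono-<; ≤ᵇ⇒≤)
  renaming (_≟_ to _≟ℕ_)
open import Data.Product using (∃; Σ; _×_; _,_; proj₁; proj₂)
open import Data.Sum as Sum using (_⊎_; inj₁; inj₂)
open import Data.Vec using (Vec; lookup) renaming ([] to []ᵛ; _∷_ to _∷ᵛ_; tabulate to tabulateᵛ)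
open import Data.Vec.Properties using (lookup∘tabulate; ≡-dec)
open import Function using (_∘_; id; Equivalence)
open import Relation.Binary.Definitions using (tri<; tri≈; tri>)
open import Relation.Binary.PropositionalEquality
  using (_≡_; _≢_; refl; sym; trans; cong; cong₂; subst; module ≡-Reasoning)
open import Relation.Nullary using (Dec; yes; no)
open import Relation.Nullary.Decidable using (⌊_⌋; toWitness; _×-dec_)

private variable
  A B : Set
  n : ℕ

module _ {p : A → Bool} where

  count-++ : ∀ xs ys → count p (xs ++ ys) ≡ count p xs + count p ys
  count-++ []       ys = refl
  count-++ (x ∷ xs) ys with p x
  ... | true  = cong suc (count-++ xs ys)
  ... | false = count-++ xs ys

  count≤length : ∀ xs → count p xs ≤ length xs
  count≤length []       = z≤n
  count≤length (x ∷ xs) with p x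
  ... | true  = s≤s (count≤length xs)
  ... | false = m≤n⇒m≤1+n (count≤length xs)

  count≡0⇒false : ∀ {x xs} → count p xs ≡ 0 → x ∈ xs → p x ≡ false
  count≡0⇒false {xs = y ∷ ys} c x∈ with p y in py
  count≡0⇒false {xs = y ∷ ys} () x∈          | true
  count≡0⇒false {xs = y ∷ ys} c (here refl)  | false = py
  count≡0⇒false {xs = y ∷ ys} c (there x∈ys) | false = count≡0⇒false c x∈ys

  count≡length⇒true : ∀ {x xs} → count p xs ≡ length xs → x ∈ xs → p x ≡ true
  count≡length⇒true {xs = y ∷ ys} c x∈ with p y in py
  count≡length⇒true {xs = y ∷ ys} c (here refl)  | true  = py
  count≡length⇒true {xs = y ∷ ys} c (there x∈ys) | true  = count≡length⇒true (suc-injective c) x∈ys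
  count≡length⇒true {xs = y ∷ ys} c x∈           | false =
    ⊥-elim (<-irrefl refl (subst (_≤ length ys) c (count≤length ys)))

  count-concatMap : (f : B → List A) → ∀ xs → count p (concatMap f xs) ≡ sum (map (count p ∘ f) xs)
  count-concatMap f []       = refl
  count-concatMap f (x ∷ xs) = trans (count-++ (f x) _) (cong (count p (f x) +_) (count-concatMap f xs))

  count-tabulate-punchIn : (f : Fin (suc n) → A) (i : Fin (suc n)) → p (f i) ≡ false →
                           count p (tabulate f) ≡ count p (tabulate (f ∘ punchIn i))
  count-tabulate-punchIn f zero pfi rewrite pfi = refl
  count-tabulate-punchIn {n = suc n} f (suc i) pfi =
    cong (λ m → if p (f zero) then suc m else m) (count-tabulate-punchIn (f ∘ suc) i pfi)

module _ {p q : A → Bool} where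

  count-cong : (∀ x → p x ≡ q x) → ∀ xs → count p xs ≡ count q xs
  count-cong p≗q []       = refl
  count-cong p≗q (x ∷ xs) rewrite p≗q x = cong (λ m → if q x then suc m else m) (count-cong p≗q xs)

  count-∧-≤ : ∀ xs → count (λ x → p x ∧ q x) xs ≤ count q xs
  count-∧-≤ []       = z≤n
  count-∧-≤ (x ∷ xs) with p x | q x
  ... | true  | true  = s≤s (count-∧-≤ xs)
  ... | true  | false = count-∧-≤ xs
  ... | false | true  = m≤n⇒m≤1+n (count-∧-≤ xs)
  ... | false | false = count-∧-≤ xs

  count-∨-disjoint : (∀ x → p x ∧ q x ≡ false) → ∀ xs →
                     count p xs + count q xs ≡ count (λ x → p x ∨ q x) xs
  count-∨-disjoint disjoint []       = refl
  count-∨-disjoint disjoint (x ∷ xs) with p x | q x | disjoint x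
  ... | true  | true  | ()
  ... | true  | false | _ = cong suc (count-∨-disjoint disjoint xs)
  ... | false | true  | _ = trans (+-suc _ _) (cong suc (count-∨-disjoint disjoint xs))
  ... | false | false | _ = count-∨-disjoint disjoint xs

  count-zipWith-∨ : ∀ xs → count (λ x → p x ∨ q x) xs ≡ count id (zipWith _∨_ (map p xs) (map q xs))
  count-zipWith-∨ []       = refl
  count-zipWith-∨ (x ∷ xs) with p x ∨ q x
  ... | true  = cong suc (count-zipWith-∨ xs)
  ... | false = count-zipWith-∨ xs

sum-tabulate-punchIn : (f : Fin (suc n) → ℕ) (i : Fin (suc n)) → f i ≡ 0 →
                       sum (tabulate f) ≡ sum (tabulate (f ∘ punchIn i))
sum-tabulate-punchIn f zero fi≡0 rewrite fi≡0 = refl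
sum-tabulate-punchIn {n = suc n} f (suc i) fi≡0 = cong (f zero +_) (sum-tabulate-punchIn (f ∘ suc) i fi≡0)

vectors : List A → (n : ℕ) → List (Vec A n)
vectors xs zero    = []ᵛ ∷ []
vectors xs (suc n) = cartesianProductWith _∷ᵛ_ xs (vectors xs n)

∈-vectors : {xs : List A} → (∀ x → x ∈ xs) → (v : Vec A n) → v ∈ vectors xs n
∈-vectors every []ᵛ      = here refl
∈-vectors every (x ∷ᵛ v) = ∈-cartesianProductWith⁺ _∷ᵛ_ (every x) (∈-vectors every v)

m+m≡10⇒m≡5 : ∀ {m} → m + m ≡ 10 → m ≡ 5
m+m≡10⇒m≡5 {m} m+m≡10 with <-cmp m 5
... | tri< m<5 _ _ = ⊥-elim (<-irrefl m+m≡10 (+-mono-< m<5 m<5))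
... | tri≈ _ m≡5 _ = m≡5
... | tri> _ _ m>5 = ⊥-elim (<-irrefl (sym m+m≡10) (+-mono-< m>5 m>5))

irregular-outdegree : ∀ {d⁺ d⁻ e} → d⁺ + e ≡ 5 → e ≤ 2 → d⁺ + d⁻ ≡ 8 → d⁺ ≢ d⁻ →
                      (d⁺ ≡ 5 × e ≡ 0) ⊎ (d⁺ ≡ 3 × e ≡ 2)
irregular-outdegree {0} refl (s≤s (s≤s ())) _ _
irregular-outdegree {1} refl (s≤s (s≤s ())) _ _
irregular-outdegree {2} refl (s≤s (s≤s ())) _ _
irregular-outdegree {3} refl _ _    _   = inj₂ (refl , refl)
irregular-outdegree {4} refl _ refl 4≢4 = ⊥-elim (4≢4 refl)
irregular-outdegree {5} refl _ _    _   = inj₁ (refl , refl)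
irregular-outdegree {suc (suc (suc (suc (suc (suc _)))))} ()

otherParts : Fin 6 → List V → ℕ
otherParts p = count (λ w → not ⌊ p ≟ proj₁ w ⌋)

otherParts-verts : ∀ i → otherParts (inject₁ i) verts5 ≡ 8 × otherParts (inject₁ i) verts6 ≡ 10
otherParts-verts zero                         = refl , refl
otherParts-verts (suc zero)                   = refl , refl
otherParts-verts (suc (suc zero))             = refl , refl
otherParts-verts (suc (suc (suc zero)))       = refl , refl
otherParts-verts (suc (suc (suc (suc zero)))) = refl , refl

-- The out-neighbourhood of a vertex of V_i among the four other partite sets of
-- G₂,₅: entry (o , b) records whether it beats v_{punchIn i o, b}.
Row : Set
Row = Vec (Vec Bool 2) 4

beats : Row → Fin 4 → Fin 2 → Bool
beats r o b = lookup (lookup r o) b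

outdegree : Row → ℕ
outdegree r = sum (map (λ o → count (beats r o) (allFin 2)) (allFin 4))

single : Fin 2 → Vec Bool 2
single a = tabulateᵛ (λ b → ⌊ b ≟ a ⌋)

SharesSingle : Row → Row → Set
SharesSingle r₀ r₁ = ∃ λ o → ∃ λ a → lookup r₀ o ≡ single a × lookup r₁ o ≡ single a

sharesSingle? : ∀ r₀ r₁ → Dec (SharesSingle r₀ r₁)
sharesSingle? r₀ r₁ = any? λ o → any? λ a →
  ≡-dec _≟ᵇ_ (lookup r₀ o) (single a) ×-dec ≡-dec _≟ᵇ_ (lookup r₁ o) (single a)

every-row : (r : Row) → r ∈ vectors (vectors (true ∷ false ∷ []) 2) 4
every-row = ∈-vectors (∈-vectors every-bool)
  where
    every-bool : ∀ b → b ∈ true ∷ false ∷ []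
    every-bool true  = here refl
    every-bool false = there (here refl)

rowsOfOutdegree : ℕ → List Row
rowsOfOutdegree d = filter (λ r → outdegree r ≟ℕ d) (vectors (vectors (true ∷ false ∷ []) 2) 4)

verdict : Row × List Bool → Row × List Bool → Bool
verdict (r₀ , z₀) (r₁ , z₁) = (count id (zipWith _∨_ z₀ z₁) ≤ᵇ 3) ∨ ⌊ sharesSingle? r₀ r₁ ⌋

verdict-sound : ∀ r₀ z₀ r₁ z₁ → T (verdict (r₀ , z₀) (r₁ , z₁)) →
                count id (zipWith _∨_ z₀ z₁) ≤ 3 ⊎ SharesSingle r₀ r₁
verdict-sound r₀ z₀ r₁ z₁ ok =
  Sum.map (≤ᵇ⇒≤ _ 3) (toWitness {a? = sharesSingle? r₀ r₁}) (Equivalence.to T-∨ ok)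

checkPairs : List (Row × List Bool) → List (Row × List Bool) → Bool
checkPairs t₀ t₁ = all (λ x₀ → all (verdict x₀) t₁) t₀

checkPairs-sound : ∀ t₀ t₁ {x₀ x₁} → checkPairs t₀ t₁ ≡ true → x₀ ∈ t₀ → x₁ ∈ t₁ → T (verdict x₀ x₁)
checkPairs-sound t₀ t₁ {x₀} ok x₀∈ x₁∈ = All.lookup (all⁺ (verdict x₀) t₁ row₀) x₁∈
  where
    row₀ : T (all (verdict x₀) t₁)
    row₀ = All.lookup (all⁺ (λ x → all (verdict x) t₁) t₀ (Equivalence.from T-≡ ok)) x₀∈

module _ (G : MultipartiteTournament) where
  open MultipartiteTournament G

  arc-reverse : ∀ {x y} → proj₁ x ≢ proj₁ y → arc y x ≡ not (arc x y)
  arc-reverse {p , a} {q , b} p≢q with total p a q b p≢q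
  ... | inj₁ xy rewrite xy = asym _ _ xy
  ... | inj₂ yx rewrite yx | asym _ _ yx = refl

  degree-sum : ∀ u L → outdegIn G L u + indegIn G L u ≡ otherParts (proj₁ u) L
  degree-sum u L = trans (count-∨-disjoint (disjoint u) L) (count-cong (either u) L)
    where
      disjoint : ∀ x y → arc x y ∧ arc y x ≡ false
      disjoint x y with arc x y in xy
      ... | true  = asym x y xy
      ... | false = refl
      either : ∀ x y → (arc x y ∨ arc y x) ≡ not ⌊ proj₁ x ≟ proj₁ y ⌋
      either (p , a) (q , b) with p ≟ q
      ... | yes refl rewrite noInside p a b | noInside p b a = refl
      ... | no p≢q   rewrite arc-reverse {p , a} {q , b} p≢q = ∨-inverseʳ (arc (p , a) (q , b))

  VertexType : V → Set
  VertexType u = (outdegIn G verts5 u ≡ 5 × outIntoPart G u V6 ≡ 0)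
               ⊎ (outdegIn G verts5 u ≡ 3 × outIntoPart G u V6 ≡ 2)

  vertex-type : Regular G → ∀ i → Irregular5 G i → ∀ a → VertexType (inject₁ i , a)
  vertex-type regular i irregular a =
    irregular-outdegree outdeg₅+toV6 (count≤length {p = λ y → arc u (V6 , y)} (allFin 2)) degree₅ (irregular a)
    where
      open ≡-Reasoning
      u : V
      u = inject₁ i , a
      degree₅ : outdegIn G verts5 u + indegIn G verts5 u ≡ 8
      degree₅ = trans (degree-sum u verts5) (proj₁ (otherParts-verts i))
      outdeg₆ : outdegIn G verts6 u ≡ 5
      outdeg₆ = m+m≡10⇒m≡5 (begin
        outdegIn G verts6 u + outdegIn G verts6 u ≡⟨ cong (outdegIn G verts6 u +_) (regular u) ⟩
        outdegIn G verts6 u + indegIn G verts6 u  ≡⟨ degree-sum u verts6 ⟩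
        otherParts (inject₁ i) verts6             ≡⟨ proj₂ (otherParts-verts i) ⟩
        10                                        ∎)
      outdeg₅+toV6 : outdegIn G verts5 u + outIntoPart G u V6 ≡ 5
      outdeg₅+toV6 = trans (sym (count-++ {p = arc u} verts5 ((V6 , zero) ∷ (V6 , suc zero) ∷ []))) outdeg₆

  controls2-of-shared-out-neighbour : ∀ {p q} → p ≢ q → (a : Fin 2) →
    (∀ x y → arc (p , x) (q , y) ≡ ⌊ y ≟ a ⌋) → Controls2 G p q
  controls2-of-shared-out-neighbour {p} {q} p≢q a shared =
    trans (cong sum (map-cong (λ x → count-cong (shared x) (allFin 2)) (allFin 2))) (two-arcs a) ,
    λ b → subst (_≢ 1) (sym (count-cong (back b) (allFin 2))) (not-one a b)
    where
      two-arcs : ∀ a → sum (map (λ _ → count (λ y → ⌊ y ≟ a ⌋) (allFin 2)) (allFin 2)) ≡ 2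
      two-arcs zero       = refl
      two-arcs (suc zero) = refl
      back : ∀ b x → arc (q , b) (p , x) ≡ not ⌊ b ≟ a ⌋
      back b x = trans (arc-reverse p≢q) (cong not (shared x b))
      not-one : ∀ a b → count (λ _ → not ⌊ b ≟ a ⌋) (allFin 2) ≢ 1
      not-one zero       zero       ()
      not-one zero       (suc zero) ()
      not-one (suc zero) zero       ()
      not-one (suc zero) (suc zero) ()

  beaten-by-V6 : ∀ {v} → proj₁ v ≢ V6 → outIntoPart G v V6 ≡ 0 → ∀ x → arc (V6 , x) v ≡ true
  beaten-by-V6 {v} v≢V6 none x =
    trans (arc-reverse v≢V6) (cong not (count≡0⇒false {p = λ y → arc v (V6 , y)} none (∈-allFin x)))

  beats-V6 : ∀ {v} → proj₁ v ≢ V6 → outIntoPart G v V6 ≡ 2 → ∀ x → arc (V6 , x) v ≡ false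
  beats-V6 {v} v≢V6 both x =
    trans (arc-reverse v≢V6) (cong not (count≡length⇒true {p = λ y → arc v (V6 , y)} both (∈-allFin x)))

  V6-controls2 : ∀ i a → outIntoPart G (inject₁ i , a) V6 ≡ 0 →
                 outIntoPart G (inject₁ i , flip2 G a) V6 ≡ 2 → Controls2 G V6 (inject₁ i)
  V6-controls2 i zero none both = controls2-of-shared-out-neighbour fromℕ≢inject₁ zero λ where
    x zero       → beaten-by-V6 (fromℕ≢inject₁ ∘ sym) none x
    x (suc zero) → beats-V6 (fromℕ≢inject₁ ∘ sym) both x
  V6-controls2 i (suc zero) none both = controls2-of-shared-out-neighbour fromℕ≢inject₁ (suc zero) λ where
    x zero       → beats-V6 (fromℕ≢inject₁ ∘ sym) both x
    x (suc zero) → beaten-by-V6 (fromℕ≢inject₁ ∘ sym) none x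

  rowOf : Fin 5 → Fin 2 → Row
  rowOf i a = tabulateᵛ λ o → tabulateᵛ λ b → arc (inject₁ i , a) (inject₁ (punchIn i o) , b)

  beats-rowOf : ∀ i a o b → beats (rowOf i a) o b ≡ arc (inject₁ i , a) (inject₁ (punchIn i o) , b)
  beats-rowOf i a o b =
    trans (cong (λ v → lookup v b) (lookup∘tabulate (tabulateᵛ ∘ arcTo) o)) (lookup∘tabulate (arcTo o) b)
    where
      arcTo : Fin 4 → Fin 2 → Bool
      arcTo o b = arc (inject₁ i , a) (inject₁ (punchIn i o) , b)

  outdegree-rowOf : ∀ i a → outdegIn G verts5 (inject₁ i , a) ≡ outdegree (rowOf i a)
  outdegree-rowOf i a = begin
    count (arc u) verts5
      ≡⟨ count-concatMap {p = arc u} part (allFin 5) ⟩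
    sum (map (count (arc u) ∘ part) (allFin 5))
      ≡⟨ cong sum (map-tabulate id (count (arc u) ∘ part)) ⟩
    sum (tabulate (count (arc u) ∘ part))
      ≡⟨ sum-tabulate-punchIn (count (arc u) ∘ part) i own-part ⟩
    sum (tabulate (count (arc u) ∘ part ∘ punchIn i))
      ≡⟨ cong sum (tabulate-cong λ o → count-cong (λ b → sym (beats-rowOf i a o b)) (allFin 2)) ⟩
    outdegree (rowOf i a) ∎
    where
      open ≡-Reasoning
      u : V
      u = inject₁ i , a
      part : Fin 5 → List V
      part j = map (λ b → inject₁ j , b) (allFin 2)
      own-part : count (arc u) (part i) ≡ 0
      own-part rewrite noInside (inject₁ i) a zero | noInside (inject₁ i) a (suc zero) = refl

  pick : Partition G → Fin 5 → Fin 2 → Fin 5 → Fin 2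
  pick s i a j = if ⌊ lookup s i ≟ a ⌋ then lookup s j else flip2 G (lookup s j)

  tourOf-tabulate : ∀ s i a → tourOf G s i a ≡ tabulate (λ j → inject₁ j , pick s i a j)
  tourOf-tabulate s i a with ⌊ lookup s i ≟ a ⌋
  ... | true  = map-tabulate id (λ j → inject₁ j , lookup s j)
  ... | false = map-tabulate id (λ j → inject₁ j , flip2 G (lookup s j))

  sourceOrSink : Row → (Fin 4 → Fin 2) → Bool
  sourceOrSink r c = isZero G (count (λ o → beats r o (c o)) (allFin 4))
                   ∨ isZero G (count (λ o → not (beats r o (c o))) (allFin 4))

  deltaZero-tourOf : ∀ s i a →
    deltaZero G (tourOf G s i a) (inject₁ i , a) ≡ sourceOrSink (rowOf i a) (pick s i a ∘ punchIn i)
  deltaZero-tourOf s i a rewrite tourOf-tabulate s i a =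
    cong₂ (λ m n → isZero G m ∨ isZero G n) outdeg-eq indeg-eq
    where
      u : V
      u = inject₁ i , a
      member : Fin 5 → V
      member j = inject₁ j , pick s i a j
      c : Fin 4 → Fin 2
      c = pick s i a ∘ punchIn i
      outdeg-eq : count (arc u) (tabulate member) ≡ count (λ o → beats (rowOf i a) o (c o)) (allFin 4)
      outdeg-eq = trans (count-tabulate-punchIn {p = arc u} member i (noInside (inject₁ i) a _))
                        (count-cong {p = arc u ∘ member ∘ punchIn i}
                                    (λ o → sym (beats-rowOf i a o (c o))) (allFin 4))
      indeg-eq : count (λ w → arc w u) (tabulate member)
               ≡ count (λ o → not (beats (rowOf i a) o (c o))) (allFin 4)
      indeg-eq = trans (count-tabulate-punchIn {p = λ w → arc w u} member i (noInside (inject₁ i) _ a))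
                       (count-cong {p = λ o → arc (member (punchIn i o)) u}
                                   (λ o → trans (arc-reverse (punchInᵢ≢i i o ∘ sym ∘ inject₁-injective))
                                                (cong not (sym (beats-rowOf i a o (c o)))))
                                   (allFin 4))

  zeroDeltaAt : Fin 5 → Row → Row → Partition G → Bool
  zeroDeltaAt i r₀ r₁ s = sourceOrSink r₀ (pick s i zero ∘ punchIn i)
                        ∨ sourceOrSink r₁ (pick s i (suc zero) ∘ punchIn i)

  zeroDeltaCount : Fin 5 → Row → Row → ℕ
  zeroDeltaCount i r₀ r₁ = count (zeroDeltaAt i r₀ r₁) (partitions G)

  -- The predicate of nV is restated verbatim: were it named, Agda would compare
  -- the two counts by unfolding them over all sixteen partitions.
  nV≤zeroDeltaCount : ∀ i → nV G i ≤ zeroDeltaCount i (rowOf i zero) (rowOf i (suc zero))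
  nV≤zeroDeltaCount i =
    ≤-trans (count-∧-≤ {p = nonStrong G}
                       {q = λ s → any (λ a → deltaZero G (tourOf G s i a) (inject₁ i , a)) (allFin 2)}
                       (partitions G))
            (≤-reflexive (count-cong {q = zeroDeltaAt i (rowOf i zero) (rowOf i (suc zero))}
                                     pointwise (partitions G)))
    where
      pointwise : ∀ s → any (λ a → deltaZero G (tourOf G s i a) (inject₁ i , a)) (allFin 2)
                      ≡ zeroDeltaAt i (rowOf i zero) (rowOf i (suc zero)) s
      pointwise s = cong₂ _∨_ (deltaZero-tourOf s i zero)
                              (trans (∨-identityʳ _) (deltaZero-tourOf s i (suc zero)))

  zeroDeltaPattern : Fin 5 → Fin 2 → Row → List Bool
  zeroDeltaPattern i a r = map (λ s → sourceOrSink r (pick s i a ∘ punchIn i)) (partitions G)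

  zeroDeltaCount-patterns : ∀ i r₀ r₁ →
    zeroDeltaCount i r₀ r₁
      ≡ count id (zipWith _∨_ (zeroDeltaPattern i zero r₀) (zeroDeltaPattern i (suc zero) r₁))
  zeroDeltaCount-patterns i r₀ r₁ =
    count-zipWith-∨ {p = λ s → sourceOrSink r₀ (pick s i zero ∘ punchIn i)}
                    {q = λ s → sourceOrSink r₁ (pick s i (suc zero) ∘ punchIn i)} (partitions G)

  -- Pairing each row with its δ = 0 pattern computes the pattern once per row
  -- instead of once per pair of rows.
  patternTable : Fin 5 → ℕ → Fin 2 → List (Row × List Bool)
  patternTable i d a = map (λ r → r , zeroDeltaPattern i a r) (rowsOfOutdegree d)

  checkAt : Fin 5 → ℕ → Bool
  checkAt i d = checkPairs (patternTable i d zero) (patternTable i d (suc zero))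

  -- partitions, tourOf, flip2 and isZero take G as an argument but never use it,
  -- so these evaluate with G abstract.
  checked : ∀ i → checkAt i 5 ≡ true × checkAt i 3 ≡ true
  checked zero                         = refl , refl
  checked (suc zero)                   = refl , refl
  checked (suc (suc zero))             = refl , refl
  checked (suc (suc (suc zero)))       = refl , refl
  checked (suc (suc (suc (suc zero)))) = refl , refl

  checkAt-holds : ∀ i d → d ≡ 5 ⊎ d ≡ 3 → checkAt i d ≡ true
  checkAt-holds i .5 (inj₁ refl) = proj₁ (checked i)
  checkAt-holds i .3 (inj₂ refl) = proj₂ (checked i)

  few-or-shared : ∀ i d → d ≡ 5 ⊎ d ≡ 3 → ∀ r₀ r₁ → outdegree r₀ ≡ d → outdegree r₁ ≡ d →
                  zeroDeltaCount i r₀ r₁ ≤ 3 ⊎ SharesSingle r₀ r₁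
  few-or-shared i d d∈ r₀ r₁ deg₀ deg₁ =
    Sum.map₁ (subst (_≤ 3) (sym (zeroDeltaCount-patterns i r₀ r₁)))
      (verdict-sound r₀ (zeroDeltaPattern i zero r₀) r₁ (zeroDeltaPattern i (suc zero) r₁)
        (checkPairs-sound (patternTable i d zero) (patternTable i d (suc zero)) (checkAt-holds i d d∈)
                          (listed zero r₀ deg₀) (listed (suc zero) r₁ deg₁)))
    where
      listed : ∀ a r → outdegree r ≡ d → (r , zeroDeltaPattern i a r) ∈ patternTable i d a
      listed a r deg = ∈-map⁺ (λ r → r , zeroDeltaPattern i a r)
                              (∈-filter⁺ (λ r → outdegree r ≟ℕ d) (every-row r) deg)

  Controls2SomeOther : Fin 5 → Set
  Controls2SomeOther i = Σ (Fin 5) λ j → j ≢ i × Controls2 G (inject₁ i) (inject₁ j)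

  controls2-of-SharesSingle : ∀ i → SharesSingle (rowOf i zero) (rowOf i (suc zero)) → Controls2SomeOther i
  controls2-of-SharesSingle i (o , a , row₀ , row₁) =
    punchIn i o , punchInᵢ≢i i o ,
    controls2-of-shared-out-neighbour (punchInᵢ≢i i o ∘ sym ∘ inject₁-injective) a arcs
    where
      row : ∀ x → lookup (rowOf i x) o ≡ single a
      row zero       = row₀
      row (suc zero) = row₁
      arcs : ∀ x y → arc (inject₁ i , x) (inject₁ (punchIn i o) , y) ≡ ⌊ y ≟ a ⌋
      arcs x y = trans (sym (beats-rowOf i x o y))
                       (trans (cong (λ v → lookup v y) (row x)) (lookup∘tabulate (λ b → ⌊ b ≟ a ⌋) y))

  equal-outdegrees⇒controls2 : ∀ i d → d ≡ 5 ⊎ d ≡ 3 →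
    outdegIn G verts5 (inject₁ i , zero) ≡ d → outdegIn G verts5 (inject₁ i , suc zero) ≡ d →
    nV G i ≡ 4 → Controls2SomeOther i
  equal-outdegrees⇒controls2 i d d∈ deg₀ deg₁ n≡4 =
    Sum.[ (λ few → ⊥-elim (<-irrefl {3} refl (subst (_≤ 3) n≡4 (nV≤ few))))
        , controls2-of-SharesSingle i ]′
      (few-or-shared i d d∈ (rowOf i zero) (rowOf i (suc zero))
         (trans (sym (outdegree-rowOf i zero)) deg₀) (trans (sym (outdegree-rowOf i (suc zero))) deg₁))
    where
      nV≤ : ∀ {k} → zeroDeltaCount i (rowOf i zero) (rowOf i (suc zero)) ≤ k → nV G i ≤ k
      nV≤ {k} = ≤-trans {nV G i} {zeroDeltaCount i (rowOf i zero) (rowOf i (suc zero))} {k}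
                        (nV≤zeroDeltaCount i)

lemma4p1 : (G : MultipartiteTournament) → Regular G →
    (i : Fin 5) → Irregular5 G i → nV G i ≡ 4 →
    (Σ (Fin 5) λ j → j ≢ i × Controls2 G (inject₁ i) (inject₁ j))
      ⊎ Controls2 G V6 (inject₁ i)
lemma4p1 G regular i irregular n≡4 =
  by-types (vertex-type G regular i irregular zero) (vertex-type G regular i irregular (suc zero))
  where
    by-types : VertexType G (inject₁ i , zero) → VertexType G (inject₁ i , suc zero) →
               Controls2SomeOther G i ⊎ Controls2 G V6 (inject₁ i)
    by-types (inj₁ (d₀ , _)) (inj₁ (d₁ , _)) = inj₁ (equal-outdegrees⇒controls2 G i 5 (inj₁ refl) d₀ d₁ n≡4)
    by-types (inj₂ (d₀ , _)) (inj₂ (d₁ , _)) = inj₁ (equal-outdegrees⇒controls2 G i 3 (inj₂ refl) d₀ d₁ n≡4)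
    by-types (inj₁ (_ , e₀)) (inj₂ (_ , e₁)) = inj₂ (V6-controls2 G i zero e₀ e₁)
    by-types (inj₂ (_ , e₀)) (inj₁ (_ , e₁)) = inj₂ (V6-controls2 G i (suc zero) e₁ e₀)
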